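{- Let $\mathcal{C}$ be a permutation class (resp. polyomino class) and let $\mathcal{M}$ be its canonical $m$-basis. The minimal $m$-bases of $\mathcal{C}$ are exactly the subsets $\mathcal{B}\subseteq\mathcal{M}$ that are minimal for inclusion under the condition $\mathcal{C}=Av_{\mathfrak{S}}(\mathcal{B})$ (resp. $\mathcal{C}=Av_{\mathfrak{P}}(\mathcal{B})$).
   Context: For binary matrices, $M'\preccurlyeq M$ means $M'$ is obtained from $M$ by deleting rows and/or columns. Permutations are identified with permutation matrices ($M_\sigma(i,j)=1$ iff $i=\sigma(j)$), polyominoes with the binary matrix of their minimal bounding rectangle (entry $1$ iff the cell belongs to the polyomino). A permutation (resp. polyomino) class is a set of permutations (resp. polyominoes) downward closed for $\preccurlyeq$ restricted to permutations (resp. polyominoes). $Av_{\mathfrak{S}}(\mathcal{B})$ (resp. $Av_{\mathfrak{P}}(\mathcal{B})$) is the set of permutations (resp. polyominoes) having no submatrix in $\mathcal{B}$. Write $Av$ for the relevant one. The canonical $m$-basis of $\mathcal{C}$ is the set of $\preccurlyeq$-minimal binary matrices not occurring as a submatrix of any element of $\mathcal{C}$. An $m$-basis of $\mathcal{C}$ is an antichain $\mathcal{M}'$ of binary matrices with $\mathcal{C}=Av(\mathcal{M}')$. A minimal $m$-basis is an $m$-basis $\mathcal{M}'$ such that (1) for every strict subset $\mathcal{M}''\subsetneq\mathcal{M}'$, $\mathcal{C}\neq Av(\mathcal{M}'')$; and (2) for every $M\in\mathcal{M}'$ and every submatrix $M'\preccurlyeq M$, either $M'=M$ or $\mathcal{C}\neq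 Av((\mathcal{M}'\setminus\{M\})\cup\{M'\})$. -}

module Defs where

open import Data.Nat using (ℕ; suc)
open import Data.Bool using (Bool; true)
open import Data.Fin using (Fin; toℕ; _<_)
open import Data.Fin.Permutation using (Permutation; _⟨$⟩ʳ_)
open import Data.Vec using (Vec; lookup)
open import Data.Product using (Σ; ∃; _×_; _,_)
open import Data.Sum using (_⊎_)
open import Relation.Nullary using (¬_)
open import Relation.Binary.PropositionalEquality using (_≡_)
open import Function.Bundles using (_⇔_)

record Mat : Set where
  constructor mat
  field
    rows : ℕ
    cols : ℕ
    ent  : Vec (Vec Bool cols) rows
open Mat public

entry : (M : Mat) → Fin (rows M) → Fin (cols M) → Bool
entry M i j = lookup (lookup (ent M) i) j

StrictlyIncreasing : {a b : ℕ} → (Fin a → Fin b) → Set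
StrictlyIncreasing f = ∀ i j → i < j → f i < f j

_≼_ : Mat → Mat → Set
M' ≼ M = Σ (Fin (rows M') → Fin (rows M)) λ f →
         Σ (Fin (cols M') → Fin (cols M)) λ g →
         StrictlyIncreasing f × StrictlyIncreasing g ×
         (∀ i j → entry M' i j ≡ entry M (f i) (g j))

IsPerm : Mat → Set
IsPerm M = Σ (Permutation (cols M) (rows M)) λ σ →
           ∀ i j → (entry M i j ≡ true) ⇔ (i ≡ σ ⟨$⟩ʳ j)

-- Polyominoes: matrix of the minimal bounding rectangle of a
-- nonempty edge-connected set of cells.

module _ (M : Mat) where
  Cell : Set
  Cell = Fin (rows M) × Fin (cols M)

  Full : Cell → Set
  Full (i , j) = entry M i j ≡ true

  Next : {k : ℕ} → Fin k → Fin k → Set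
  Next a b = suc (toℕ a) ≡ toℕ b ⊎ suc (toℕ b) ≡ toℕ a

  Adj : Cell → Cell → Set
  Adj (i , j) (i' , j') = (i ≡ i' × Next j j') ⊎ (j ≡ j' × Next i i')

  data Path : Cell → Cell → Set where
    here : ∀ {c} → Path c c
    step : ∀ {c d e} → Adj c d → Full d → Path d e → Path c e

IsPoly : Mat → Set
IsPoly M = (∃ λ (c : Cell M) → Full M c)
         × (∀ i → ∃ λ j → entry M i j ≡ true)
         × (∀ j → ∃ λ i → entry M i j ≡ true)
         × (∀ c d → Full M c → Full M d → Path M c d)

data Kind : Set where
  perms polys : Kind

Obj : Kind → Mat → Set
Obj perms = IsPerm
Obj polys = IsPoly

MSet : Set₁
MSet = Mat → Set

_⊆_ : MSet → MSet → Set
A ⊆ B = ∀ M → A M → B M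

_≐_ : MSet → MSet → Set
A ≐ B = A ⊆ B × B ⊆ A

_⊊_ : MSet → MSet → Set
A ⊊ B = A ⊆ B × ∃ λ M → B M × ¬ A M

IsClass : Kind → MSet → Set
IsClass k C = (C ⊆ Obj k) ×
  (∀ M M' → C M → Obj k M' → M' ≼ M → C M')

Av : Kind → MSet → MSet
Av k B M = Obj k M × (∀ P → B P → ¬ (P ≼ M))

NotOccurring : MSet → Mat → Set
NotOccurring C M = ∀ P → C P → ¬ (M ≼ P)

CanonicalBasis : MSet → MSet
CanonicalBasis C M = NotOccurring C M × (∀ M' → M' ≼ M → NotOccurring C M' → M' ≡ M)

Antichain : MSet → Set
Antichain B = ∀ M M' → B M → B M' → M ≼ M' → M ≡ M'

IsMBasis : Kind → MSet → MSet → Set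
IsMBasis k C B = Antichain B × (C ≐ Av k B)

Replace : MSet → Mat → Mat → MSet
Replace B M M' X = (B X × ¬ (X ≡ M)) ⊎ X ≡ M'

IsMinimalMBasis : Kind → MSet → MSet → Set₁
IsMinimalMBasis k C B =
  IsMBasis k C B
  × (∀ (B' : MSet) → B' ⊊ B → ¬ (C ≐ Av k B'))
  × (∀ M M' → B M → M' ≼ M → M' ≡ M ⊎ ¬ (C ≐ Av k (Replace B M M')))

InclusionMinimalSubBasis : Kind → MSet → MSet → Set₁
InclusionMinimalSubBasis k C B =
  B ⊆ CanonicalBasis C
  × (C ≐ Av k B)
  × (∀ (B' : MSet) → B' ⊊ B → ¬ (C ≐ Av k B'))

module Submission where

-- Let C = Av(B). Every basis element M ∈ B is absent from C (it would occur in
-- itself), and conversely Av(B) is unchanged when M ∈ B is replaced by a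
-- submatrix M' ≼ M that is itself absent from C: avoiding M' implies avoiding
-- M, and a matrix of Av(B) cannot contain M' since M' does not occur in C.
-- Hence condition (2) of minimality says precisely that no proper submatrix of
-- a basis element is absent from C, i.e. that B lies inside the canonical
-- m-basis. Being an antichain is then automatic, because the canonical
-- m-basis is one, and condition (1) is common to both notions.

open import Defs
open import Level using (0ℓ)
open import Axiom.ExcludedMiddle using (ExcludedMiddle)
open import Function.Bundles using (_⇔_; mk⇔)
open import Data.Nat.Properties using () renaming (_≟_ to _≟ℕ_)
open import Data.Bool.Properties using () renaming (_≟_ to _≟𝔹_)
open import Data.Vec.Properties using (≡-dec)
open import Data.Product using (_×_; _,_; proj₁; proj₂)
open import Data.Sum using (_⊎_; inj₁; inj₂)
open import Data.Empty using (⊥-elim)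
open import Relation.Nullary using (¬_; yes; no)
open import Relation.Binary.Definitions using (DecidableEquality)
open import Relation.Binary.PropositionalEquality using (_≡_; refl; trans)

≼-trans : ∀ {A B C} → A ≼ B → B ≼ C → A ≼ C
≼-trans (f , g , f↑ , g↑ , eq) (f' , g' , f'↑ , g'↑ , eq') =
  (λ i → f' (f i)) , (λ j → g' (g j)) ,
  (λ i j i<j → f'↑ _ _ (f↑ i j i<j)) , (λ i j i<j → g'↑ _ _ (g↑ i j i<j)) ,
  (λ i j → trans (eq i j) (eq' (f i) (g j)))

-- Equality of binary matrices is decidable: compare dimensions, then entries.
-- This replaces every case distinction "is X equal to M?" in the argument.
_≟ᴹ_ : DecidableEquality Mat
mat r c e ≟ᴹ mat r' c' e' with r ≟ℕ r' | c ≟ℕ c'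
... | no r≢r' | _ = no λ { refl → r≢r' refl }
... | yes _ | no c≢c' = no λ { refl → c≢c' refl }
... | yes refl | yes refl with ≡-dec (≡-dec _≟𝔹_) e e'
...   | yes refl = yes refl
...   | no e≢e' = no λ { refl → e≢e' refl }

-- The canonical m-basis of any set of matrices is an antichain: a basis
-- element contained in another is absent from C, so minimality forces equality.
canonical-antichain : (C : MSet) → Antichain (CanonicalBasis C)
canonical-antichain C M M' (absentM , _) (_ , minimalM') M≼M' =
  minimalM' M M≼M' absentM

antichain-⊆ : {A B : MSet} → A ⊆ B → Antichain B → Antichain A
antichain-⊆ A⊆B antiB M M' AM AM' = antiB M M' (A⊆B M AM) (A⊆B M' AM')

module _ (k : Kind) (C : MSet) (B : MSet) where

  basis-absent : C ⊆ Av k B → ∀ M → B M → NotOccurring C M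
  basis-absent C⊆Av M BM P CP M≼P = proj₂ (C⊆Av P CP) M BM M≼P

  module _ {M M' : Mat} where

    replacement-absent : C ⊆ Av k (Replace B M M') → NotOccurring C M'
    replacement-absent C⊆Av P CP M'≼P = proj₂ (C⊆Av P CP) M' (inj₂ refl) M'≼P

    replacement-preserves : C ≐ Av k B → B M → M' ≼ M → NotOccurring C M' →
                            C ≐ Av k (Replace B M M')
    replacement-preserves (C⊆Av , Av⊆C) BM M'≼M absentM' =
      C⊆Av' , Av'⊆C
      where
      C⊆Av' : C ⊆ Av k (Replace B M M')
      C⊆Av' X CX = proj₁ (C⊆Av X CX) , avoids
        where
        avoids : ∀ P → Replace B M M' P → ¬ (P ≼ X)
        avoids P (inj₁ (BP , _)) = proj₂ (C⊆Av X CX) P BP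
        avoids P (inj₂ refl) = absentM' X CX

      -- An object avoiding M' avoids M ≽ M', hence avoids all of B.
      Av'⊆C : Av k (Replace B M M') ⊆ C
      Av'⊆C X (objX , avoidsX) = Av⊆C X (objX , avoids)
        where
        avoids : ∀ P → B P → ¬ (P ≼ X)
        avoids P BP P≼X with P ≟ᴹ M
        ... | yes refl = avoidsX M' (inj₂ refl) (≼-trans {M'} {M} {X} M'≼M P≼X)
        ... | no P≢M = avoidsX P (inj₁ (BP , P≢M)) P≼X

  minimal⇒canonical : C ≐ Av k B →
    (∀ M M' → B M → M' ≼ M → M' ≡ M ⊎ ¬ (C ≐ Av k (Replace B M M'))) →
    B ⊆ CanonicalBasis C
  minimal⇒canonical C≐AvB noShrinking M BM =
    basis-absent (proj₁ C≐AvB) M BM , minimal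
    where
    minimal : ∀ M' → M' ≼ M → NotOccurring C M' → M' ≡ M
    minimal M' M'≼M absentM' with noShrinking M M' BM M'≼M
    ... | inj₁ M'≡M = M'≡M
    ... | inj₂ changes =
      ⊥-elim (changes (replacement-preserves C≐AvB BM M'≼M absentM'))

  -- Conversely, for B inside the canonical m-basis no proper submatrix of a
  -- basis element can replace it: it would be absent from C, contradicting
  -- the minimality of canonical basis elements.
  canonical⇒no-shrinking : B ⊆ CanonicalBasis C →
    ∀ M M' → B M → M' ≼ M → M' ≡ M ⊎ ¬ (C ≐ Av k (Replace B M M'))
  canonical⇒no-shrinking B⊆canon M M' BM M'≼M with M' ≟ᴹ M
  ... | yes M'≡M = inj₁ M'≡M
  ... | no M'≢M = inj₂ λ (C⊆Av' , _) →
    M'≢M (proj₂ (B⊆canon M BM) M' M'≼M (replacement-absent C⊆Av'))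

-- Excluded middle is not needed: the only case distinctions are on matrix
-- equality, which is decidable. Neither is the hypothesis that C is a class.
mainTheorem8 : ExcludedMiddle 0ℓ → (k : Kind) (C : MSet) → IsClass k C →
    (B : MSet) → IsMinimalMBasis k C B ⇔ InclusionMinimalSubBasis k C B
mainTheorem8 _ k C _ B = mk⇔ minimal⇒sub sub⇒minimal
  where
  minimal⇒sub : IsMinimalMBasis k C B → InclusionMinimalSubBasis k C B
  minimal⇒sub ((_ , C≐AvB) , noSubset , noShrinking) =
    minimal⇒canonical k C B C≐AvB noShrinking , C≐AvB , noSubset

  sub⇒minimal : InclusionMinimalSubBasis k C B → IsMinimalMBasis k C B
  sub⇒minimal (B⊆canon , C≐AvB , noSubset) =
    (antichain-⊆ B⊆canon (canonical-antichain C) , C≐AvB) ,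
    noSubset , canonical⇒no-shrinking k C B B⊆canon
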